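{- For every even integer $n\ge4$, $\pi(K_n\square K_n)\le \frac{n^2}{2}$.
   Context: $K_n$ is the complete graph on $n$ vertices. For graphs $G,H$, the Cartesian product $G\square H$ has vertex set $V(G)\times V(H)$, with $(g,h)\sim(g',h')$ iff ($g=g'$ and $hh'\in E(H)$) or ($h=h'$ and $gg'\in E(G)$). A vertex coloring $c$ of a graph is non-repetitive if there is no path $v_1,\dots,v_{2k}$ ($k\ge1$, distinct vertices, consecutive ones adjacent) with $c(v_i)=c(v_{k+i})$ for all $1\le i\le k$; $\pi(G)$ denotes the minimum number of colors in a non-repetitive coloring of $G$. -}

module Defs where

open import Level using (Level; _⊔_) renaming (suc to lsuc)
open import Data.Nat using (ℕ; zero; suc; _+_; _*_; _/_; _≤_)
open import Data.Nat.Properties using ()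
open import Data.Fin using (Fin; inject₁; raise; _↑ˡ_; _↑ʳ_) renaming (suc to fsuc)
open import Data.Vec using (Vec; lookup)
open import Data.Product using (_×_; _,_; Σ; ∃; proj₁; proj₂)
open import Data.Sum using (_⊎_; inj₁; inj₂)
open import Relation.Binary.PropositionalEquality using (_≡_; _≢_; refl)
open import Relation.Nullary using (¬_)
open import Function.Definitions using (Injective)

record Graph : Set₁ where
  field
    V    : Set
    Adj  : V → V → Set
    sym  : ∀ {x y} → Adj x y → Adj y x
    irr  : ∀ {x} → ¬ Adj x x
open Graph public

K : ℕ → Graph
K n = record
  { V = Fin n
  ; Adj = λ i j → i ≢ j
  ; sym = λ p q → p (Relation.Binary.PropositionalEquality.sym q)
  ; irr = λ p → p Relation.Binary.PropositionalEquality.refl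
  }

□Adj : (G H : Graph) → V G × V H → V G × V H → Set
□Adj G H (g , h) (g' , h') = (g ≡ g' × Adj H h h') ⊎ (h ≡ h' × Adj G g g')

□sym : (G H : Graph) → ∀ {x y} → □Adj G H x y → □Adj G H y x
□sym G H {g , h} {g' , h'} (inj₁ (refl , a)) = inj₁ (refl , Graph.sym H a)
□sym G H {g , h} {g' , h'} (inj₂ (refl , a)) = inj₂ (refl , Graph.sym G a)

□irr : (G H : Graph) → ∀ {x} → ¬ □Adj G H x x
□irr G H {g , h} (inj₁ (_ , a)) = Graph.irr H a
□irr G H {g , h} (inj₂ (_ , a)) = Graph.irr G a

_□_ : Graph → Graph → Graph
G □ H = record { V = V G × V H ; Adj = □Adj G H ; sym = □sym G H ; irr = □irr G H }

IsPath : (G : Graph) {m : ℕ} → Vec (V G) m → Set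
IsPath G {m} vs =
  Injective _≡_ _≡_ (lookup vs) ×
  (∀ (i : Fin m) (j : Fin m) → Data.Fin.toℕ j ≡ suc (Data.Fin.toℕ i) →
     Adj G (lookup vs i) (lookup vs j))

-- A coloring c : V G → C is non-repetitive if there is no path v_1..v_{2k}
-- (k ≥ 1, written k = suc k') with c(v_i) = c(v_{k+i}) for all 1 ≤ i ≤ k.
NonRepetitive : (G : Graph) {C : Set} → (V G → C) → Set
NonRepetitive G c =
  ∀ (k : ℕ) (vs : Vec (V G) (suc k + suc k)) → IsPath G vs →
    ¬ (∀ (i : Fin (suc k)) → c (lookup vs (i ↑ˡ suc k)) ≡ c (lookup vs (suc k ↑ʳ i)))

πAtMost : Graph → ℕ → Set
πAtMost G t = ∃ λ (c : V G → Fin t) → NonRepetitive G c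

-- Split the n = 2m rows and columns of the rook's graph K n □ K n into halves, giving four m × m
-- quadrants, and give every colour to exactly two cells ("twins") lying in diagonally opposite
-- quadrants: (a, b) top-left with (a, b) bottom-right, and (p a, p b) top-right with (a, b)
-- bottom-left, for a fixed-point-free permutation p of Fin m. If v₁ … v₂ₖ were a repetitive path,
-- then vᵢ and vₖ₊ᵢ are twins, and the twist p guarantees that an edge vᵢvᵢ₊₁ whose twin pair
-- vₖ₊ᵢvₖ₊ᵢ₊₁ is again an edge stays inside one quadrant. So v₁ … vₖ lie in the quadrant of v₁,
-- and vₖ is adjacent to vₖ₊₁, the twin of v₁ — impossible, as no cell shares a row or a column
-- with a cell of the opposite quadrant.
module Submission where

open import Defs
open import Data.Nat using (ℕ; _*_; _/_; _≤_)
open import Data.Nat.Properties using ()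
open import Data.Nat.Divisibility using (_∣_)

open import Data.Bool using (Bool; true; false; not)
open import Data.Bool.Properties using (¬-not)
open import Data.Empty using (⊥-elim)
open import Data.Fin using (Fin; toℕ; fromℕ; inject₁; lower₁; splitAt; join; combine; _↑ˡ_; _↑ʳ_)
  renaming (zero to fzero; suc to fsuc)
open import Data.Fin.Induction using (<-weakInduction)
open import Data.Fin.Properties
  using (toℕ-injective; toℕ-↑ˡ; toℕ-↑ʳ; toℕ<n; toℕ-inject₁; toℕ-fromℕ; toℕ-lower₁; lower₁-injective;
         suc-injective; +↔⊎; combine-injective)
open import Data.Nat using (suc; _+_; s≤s)
open import Data.Nat.Divisibility using (divides)
open import Data.Nat.DivMod using (m*n/n≡m)
open import Data.Nat.Properties using (_≟_; <-irrefl; <-≤-trans; m≤m+n; +-suc; +-identityʳ; 1+n≢n; *-comm; *-assoc)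
open import Data.Product using (_×_; _,_; proj₁; proj₂)
open import Data.Sum using (_⊎_; inj₁; inj₂)
open import Data.Sum.Properties using (inj₁-injective; inj₂-injective)
open import Data.Vec using (Vec; lookup; map)
open import Data.Vec.Properties using (lookup-map)
open import Function using (_∘_)
open import Function.Bundles using (Injection)
open import Function.Definitions using (Injective)
open import Function.Properties.Inverse using (↔⇒↣; ↔-sym)
open import Relation.Binary.PropositionalEquality
  using (_≡_; _≢_; refl; trans; cong; cong₂; subst; subst₂; module ≡-Reasoning)
  renaming (sym to ≡-sym)
open import Relation.Nullary using (¬_; yes; no)

complements-≡ : ∀ {x x′ y y′ : Bool} → x ≢ x′ → y ≢ y′ → x′ ≡ y′ → x ≡ y
complements-≡ x≢x′ y≢y′ x′≡y′ = trans (¬-not x≢x′) (trans (cong not x′≡y′) (≡-sym (¬-not y≢y′)))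

splitAt-injective : ∀ m {n} → Injective _≡_ _≡_ (splitAt m {n})
splitAt-injective m = Injection.injective (↔⇒↣ +↔⊎)

join-injective : ∀ m n → Injective _≡_ _≡_ (join m n)
join-injective m n = Injection.injective (↔⇒↣ (↔-sym (+↔⊎ {m} {n})))

Complete : Set → Graph
Complete A = record
  { V = A
  ; Adj = _≢_
  ; sym = λ x≢y y≡x → x≢y (≡-sym y≡x)
  ; irr = λ x≢x → x≢x refl
  }

recolour-nonRepetitive : ∀ {G : Graph} {C D : Set} {c : V G → C} {e : C → D} →
                         Injective _≡_ _≡_ e → NonRepetitive G c → NonRepetitive G (e ∘ c)
recolour-nonRepetitive e-injective nonRep k vs path repeats = nonRep k vs path (e-injective ∘ repeats)

module _ {G H : Graph} {f : V G → V H} (f-injective : Injective _≡_ _≡_ f)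
         (f-adj : ∀ {x y} → Adj G x y → Adj H (f x) (f y)) where

  map-isPath : ∀ {m} {vs : Vec (V G) m} → IsPath G vs → IsPath H (map f vs)
  map-isPath {vs = vs} (injective , adjacent) = map-injective , map-adjacent
    where
    map-injective : Injective _≡_ _≡_ (lookup (map f vs))
    map-injective {i} {j} e = injective (f-injective (begin
      f (lookup vs i)     ≡⟨ lookup-map i f vs ⟨
      lookup (map f vs) i ≡⟨ e ⟩
      lookup (map f vs) j ≡⟨ lookup-map j f vs ⟩
      f (lookup vs j)     ∎))
      where open ≡-Reasoning
    map-adjacent : ∀ i j → toℕ j ≡ suc (toℕ i) → Adj H (lookup (map f vs) i) (lookup (map f vs) j)
    map-adjacent i j j≡1+i =
      subst₂ (Adj H) (≡-sym (lookup-map i f vs)) (≡-sym (lookup-map j f vs)) (f-adj (adjacent i j j≡1+i))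

  pullback-nonRepetitive : ∀ {C} {c : V H → C} → NonRepetitive H c → NonRepetitive G (c ∘ f)
  pullback-nonRepetitive {c = c} nonRep k vs path repeats = nonRep k (map f vs) (map-isPath {vs = vs} path) λ i →
    trans (cong c (lookup-map _ f vs)) (trans (repeats i) (≡-sym (cong c (lookup-map _ f vs))))

module _ (G : Graph) {C B : Set} (c : V G → C) (block : V G → B)
  (twin-separated : ∀ {x y z} → c x ≡ c y → x ≢ y → block z ≡ block x → ¬ Adj G z y)
  (twin-edge-in-block : ∀ {u w u′ w′} → Adj G u w → Adj G u′ w′ →
                        c u ≡ c u′ → c w ≡ c w′ → u ≢ u′ → w ≢ w′ → block u ≡ block w) where

  nonRepetitive-byTwinBlocks : NonRepetitive G c
  nonRepetitive-byTwinBlocks k vs (injective , adjacent) repeats =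
    twin-separated (repeats fzero) (first≢second fzero) (block-constant (fromℕ k)) last-adjacent
    where
    open ≡-Reasoning
    ℓ = suc k

    first second : Fin ℓ → V G
    first i = lookup vs (i ↑ˡ ℓ)
    second i = lookup vs (ℓ ↑ʳ i)

    first≢second : ∀ i → first i ≢ second i
    first≢second i e = <-irrefl (begin
      toℕ i            ≡⟨ toℕ-↑ˡ i ℓ ⟨
      toℕ (i ↑ˡ ℓ)     ≡⟨ cong toℕ (injective e) ⟩
      toℕ (ℓ ↑ʳ i)     ≡⟨ toℕ-↑ʳ ℓ i ⟩
      ℓ + toℕ i        ∎) (<-≤-trans (toℕ<n i) (m≤m+n ℓ (toℕ i)))

    first-adjacent : ∀ (i : Fin k) → Adj G (first (inject₁ i)) (first (fsuc i))
    first-adjacent i = adjacent _ _ (cong suc (begin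
      toℕ (i ↑ˡ ℓ)           ≡⟨ toℕ-↑ˡ i ℓ ⟩
      toℕ i                  ≡⟨ toℕ-inject₁ i ⟨
      toℕ (inject₁ i)        ≡⟨ toℕ-↑ˡ (inject₁ i) ℓ ⟨
      toℕ (inject₁ i ↑ˡ ℓ)   ∎))

    second-adjacent : ∀ (i : Fin k) → Adj G (second (inject₁ i)) (second (fsuc i))
    second-adjacent i = adjacent _ _ (begin
      toℕ (ℓ ↑ʳ fsuc i)          ≡⟨ toℕ-↑ʳ ℓ (fsuc i) ⟩
      ℓ + suc (toℕ i)            ≡⟨ +-suc ℓ (toℕ i) ⟩
      suc (ℓ + toℕ i)            ≡⟨ cong (λ j → suc (ℓ + j)) (toℕ-inject₁ i) ⟨
      suc (ℓ + toℕ (inject₁ i))  ≡⟨ cong suc (toℕ-↑ʳ ℓ (inject₁ i)) ⟨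
      suc (toℕ (ℓ ↑ʳ inject₁ i)) ∎)

    last-adjacent : Adj G (first (fromℕ k)) (second fzero)
    last-adjacent = adjacent _ _ (begin
      toℕ (ℓ ↑ʳ fzero)         ≡⟨ toℕ-↑ʳ ℓ fzero ⟩
      ℓ + 0                    ≡⟨ +-identityʳ ℓ ⟩
      suc k                    ≡⟨ cong suc (toℕ-fromℕ k) ⟨
      suc (toℕ (fromℕ k))      ≡⟨ cong suc (toℕ-↑ˡ (fromℕ k) ℓ) ⟨
      suc (toℕ (fromℕ k ↑ˡ ℓ)) ∎)

    block-constant : ∀ i → block (first i) ≡ block (first fzero)
    block-constant = <-weakInduction (λ i → block (first i) ≡ block (first fzero)) refl λ i ih →
      trans (≡-sym (twin-edge-in-block (first-adjacent i) (second-adjacent i)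
                     (repeats (inject₁ i)) (repeats (fsuc i)) (first≢second _) (first≢second _)))
            ih

rotate : ∀ {n} → Fin (suc n) → Fin (suc n)
rotate {n} i with n ≟ toℕ i
... | yes _ = fzero
... | no n≢i = fsuc (lower₁ i n≢i)

rotate-injective : ∀ {n} → Injective _≡_ _≡_ (rotate {n})
rotate-injective {n} {i} {j} e with n ≟ toℕ i | n ≟ toℕ j
... | yes n≡i | yes n≡j = toℕ-injective (trans (≡-sym n≡i) n≡j)
... | no _    | no _    = lower₁-injective (suc-injective e)
... | yes _   | no _    with () ← e
... | no _    | yes _   with () ← e

rotate-fixedPointFree : ∀ {n} (i : Fin (suc (suc n))) → rotate i ≢ i
rotate-fixedPointFree {n} i e with suc n ≟ toℕ i
rotate-fixedPointFree {n} i e | yes n≡i with () ← trans n≡i (cong toℕ (≡-sym e))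
rotate-fixedPointFree {n} i e | no n≢i = 1+n≢n (begin
  suc (toℕ i)             ≡⟨ cong suc (toℕ-lower₁ i n≢i) ⟨
  toℕ (fsuc (lower₁ i _)) ≡⟨ cong toℕ e ⟩
  toℕ i                   ∎)
  where open ≡-Reasoning

module Quadrants (m : ℕ) (p : Fin m → Fin m) (p-injective : Injective _≡_ _≡_ p)
                 (p-fixedPointFree : ∀ a → p a ≢ a) where

  Half : Set
  Half = Fin m ⊎ Fin m

  Board : Graph
  Board = Complete Half □ Complete Half

  Cell : Set
  Cell = V Board

  side : Half → Bool
  side (inj₁ _) = true
  side (inj₂ _) = false

  quadrant : Cell → Bool × Bool
  quadrant (r , c) = side r , side c

  colour : Cell → Fin m × Half
  colour (inj₁ a , s)      = a , s
  colour (inj₂ a , inj₂ b) = a , inj₁ b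
  colour (inj₂ a , inj₁ b) = p a , inj₂ (p b)

  data Twins : Cell → Cell → Set where
    tl-br : ∀ a b → Twins (inj₁ a , inj₁ b) (inj₂ a , inj₂ b)
    br-tl : ∀ a b → Twins (inj₂ a , inj₂ b) (inj₁ a , inj₁ b)
    tr-bl : ∀ a b → Twins (inj₁ (p a) , inj₂ (p b)) (inj₂ a , inj₁ b)
    bl-tr : ∀ a b → Twins (inj₂ a , inj₁ b) (inj₁ (p a) , inj₂ (p b))

  twins : ∀ {x y} → colour x ≡ colour y → x ≢ y → Twins x y
  twins {inj₁ a , s}      {inj₁ .a , .s}               refl x≢y = ⊥-elim (x≢y refl)
  twins {inj₁ a , inj₁ b} {inj₂ .a , inj₂ .b}          refl _   = tl-br a b
  twins {inj₁ _ , inj₂ _} {inj₂ _ , inj₂ _}            ()   _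
  twins {inj₁ _ , inj₁ _} {inj₂ _ , inj₁ _}            ()   _
  twins {inj₁ .(p a) , inj₂ .(p b)} {inj₂ a , inj₁ b}  refl _   = tr-bl a b
  twins {inj₂ a , inj₂ b} {inj₁ .a , inj₁ .b}          refl _   = br-tl a b
  twins {inj₂ _ , inj₂ _} {inj₁ _ , inj₂ _}            ()   _
  twins {inj₂ _ , inj₁ _} {inj₁ _ , inj₁ _}            ()   _
  twins {inj₂ a , inj₁ b} {inj₁ .(p a) , inj₂ .(p b)}  refl _   = bl-tr a b
  twins {inj₂ a , inj₂ b} {inj₂ .a , inj₂ .b}          refl x≢y = ⊥-elim (x≢y refl)
  twins {inj₂ _ , inj₂ _} {inj₂ _ , inj₁ _}            ()   _
  twins {inj₂ _ , inj₁ _} {inj₂ _ , inj₂ _}            ()   _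
  twins {inj₂ a , inj₁ b} {inj₂ a′ , inj₁ b′}          e    x≢y =
    ⊥-elim (x≢y (cong₂ _,_ (cong inj₂ (p-injective (cong proj₁ e)))
                           (cong inj₁ (p-injective (inj₂-injective (cong proj₂ e))))))

  twins-opposite : ∀ {x y} → Twins x y →
                   side (proj₁ x) ≢ side (proj₁ y) × side (proj₂ x) ≢ side (proj₂ y)
  twins-opposite (tl-br _ _) = (λ ()) , (λ ())
  twins-opposite (br-tl _ _) = (λ ()) , (λ ())
  twins-opposite (tr-bl _ _) = (λ ()) , (λ ())
  twins-opposite (bl-tr _ _) = (λ ()) , (λ ())

  twins-sameRow : ∀ {u u′ w w′} → Twins u u′ → Twins w w′ →
                  proj₁ u ≡ proj₁ w → proj₁ u′ ≡ proj₁ w′ → side (proj₂ u) ≡ side (proj₂ w)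
  twins-sameRow (tl-br _ _) (tl-br _ _) _    _ = refl
  twins-sameRow (br-tl _ _) (br-tl _ _) _    _ = refl
  twins-sameRow (tr-bl _ _) (tr-bl _ _) _    _ = refl
  twins-sameRow (bl-tr _ _) (bl-tr _ _) _    _ = refl
  twins-sameRow (tl-br _ _) (tr-bl c _) refl e = ⊥-elim (p-fixedPointFree c (inj₂-injective e))
  twins-sameRow (tr-bl a _) (tl-br _ _) refl e = ⊥-elim (p-fixedPointFree a (≡-sym (inj₂-injective e)))
  twins-sameRow (br-tl a _) (bl-tr _ _) refl e = ⊥-elim (p-fixedPointFree a (≡-sym (inj₁-injective e)))
  twins-sameRow (bl-tr a _) (br-tl _ _) refl e = ⊥-elim (p-fixedPointFree a (inj₁-injective e))
  twins-sameRow (tl-br _ _) (br-tl _ _) ()   _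
  twins-sameRow (tl-br _ _) (bl-tr _ _) ()   _
  twins-sameRow (br-tl _ _) (tl-br _ _) ()   _
  twins-sameRow (br-tl _ _) (tr-bl _ _) ()   _
  twins-sameRow (tr-bl _ _) (br-tl _ _) ()   _
  twins-sameRow (tr-bl _ _) (bl-tr _ _) ()   _
  twins-sameRow (bl-tr _ _) (tl-br _ _) ()   _
  twins-sameRow (bl-tr _ _) (tr-bl _ _) ()   _

  twins-sameColumn : ∀ {u u′ w w′} → Twins u u′ → Twins w w′ →
                     proj₂ u ≡ proj₂ w → proj₂ u′ ≡ proj₂ w′ → side (proj₁ u) ≡ side (proj₁ w)
  twins-sameColumn (tl-br _ _) (tl-br _ _) _    _ = refl
  twins-sameColumn (br-tl _ _) (br-tl _ _) _    _ = refl
  twins-sameColumn (tr-bl _ _) (tr-bl _ _) _    _ = refl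
  twins-sameColumn (bl-tr _ _) (bl-tr _ _) _    _ = refl
  twins-sameColumn (tl-br _ b) (bl-tr _ _) refl e = ⊥-elim (p-fixedPointFree b (≡-sym (inj₂-injective e)))
  twins-sameColumn (bl-tr _ b) (tl-br _ _) refl e = ⊥-elim (p-fixedPointFree b (inj₂-injective e))
  twins-sameColumn (tr-bl _ b) (br-tl _ _) refl e = ⊥-elim (p-fixedPointFree b (≡-sym (inj₁-injective e)))
  twins-sameColumn (br-tl _ _) (tr-bl _ d) refl e = ⊥-elim (p-fixedPointFree d (inj₁-injective e))
  twins-sameColumn (tl-br _ _) (br-tl _ _) ()   _
  twins-sameColumn (tl-br _ _) (tr-bl _ _) ()   _
  twins-sameColumn (br-tl _ _) (tl-br _ _) ()   _
  twins-sameColumn (br-tl _ _) (bl-tr _ _) ()   _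
  twins-sameColumn (tr-bl _ _) (tl-br _ _) ()   _
  twins-sameColumn (tr-bl _ _) (bl-tr _ _) ()   _
  twins-sameColumn (bl-tr _ _) (br-tl _ _) ()   _
  twins-sameColumn (bl-tr _ _) (tr-bl _ _) ()   _

  twin-separated : ∀ {x y z} → colour x ≡ colour y → x ≢ y → quadrant z ≡ quadrant x → ¬ Adj Board z y
  twin-separated same x≢y z∼x (inj₁ (sameRow , _)) =
    proj₁ (twins-opposite (twins same x≢y)) (trans (≡-sym (cong proj₁ z∼x)) (cong side sameRow))
  twin-separated same x≢y z∼x (inj₂ (sameColumn , _)) =
    proj₂ (twins-opposite (twins same x≢y)) (trans (≡-sym (cong proj₂ z∼x)) (cong side sameColumn))

  twins-edge-in-quadrant : ∀ {u u′ w w′} → Adj Board u w → Adj Board u′ w′ → Twins u u′ → Twins w w′ →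
                           quadrant u ≡ quadrant w
  twins-edge-in-quadrant (inj₁ (row , _)) (inj₁ (row′ , _)) tu tw =
    cong₂ _,_ (cong side row) (twins-sameRow tu tw row row′)
  twins-edge-in-quadrant (inj₁ (row , _)) (inj₂ (column′ , _)) tu tw =
    cong₂ _,_ (cong side row)
              (complements-≡ (proj₂ (twins-opposite tu)) (proj₂ (twins-opposite tw)) (cong side column′))
  twins-edge-in-quadrant (inj₂ (column , _)) (inj₁ (row′ , _)) tu tw =
    cong₂ _,_ (complements-≡ (proj₁ (twins-opposite tu)) (proj₁ (twins-opposite tw)) (cong side row′))
              (cong side column)
  twins-edge-in-quadrant (inj₂ (column , _)) (inj₂ (column′ , _)) tu tw =
    cong₂ _,_ (twins-sameColumn tu tw column column′) (cong side column)

  board-nonRepetitive : NonRepetitive Board colour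
  board-nonRepetitive = nonRepetitive-byTwinBlocks Board colour quadrant twin-separated
    λ u∼w u′∼w′ cu cw u≢u′ w≢w′ → twins-edge-in-quadrant u∼w u′∼w′ (twins cu u≢u′) (twins cw w≢w′)

  Rooks : Graph
  Rooks = K (m + m) □ K (m + m)

  halves : V Rooks → Cell
  halves (r , c) = splitAt m r , splitAt m c

  halves-injective : Injective _≡_ _≡_ halves
  halves-injective e = cong₂ _,_ (splitAt-injective m (cong proj₁ e)) (splitAt-injective m (cong proj₂ e))

  halves-adj : ∀ {x y} → Adj Rooks x y → Adj Board (halves x) (halves y)
  halves-adj (inj₁ (sameRow , c≢c′))    = inj₁ (cong (splitAt m) sameRow , c≢c′ ∘ splitAt-injective m)
  halves-adj (inj₂ (sameColumn , r≢r′)) = inj₂ (cong (splitAt m) sameColumn , r≢r′ ∘ splitAt-injective m)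

  encode : Fin m × Half → Fin (m * (m + m))
  encode (a , s) = combine a (join m m s)

  encode-injective : Injective _≡_ _≡_ encode
  encode-injective {a , s} {b , t} e with combine-injective a (join m m s) b (join m m t) e
  ... | refl , js≡jt = cong (a ,_) (join-injective m m js≡jt)

  quadrant-colouring : πAtMost Rooks (m * (m + m))
  quadrant-colouring = encode ∘ colour ∘ halves ,
    pullback-nonRepetitive {G = Rooks} {H = Board} halves-injective halves-adj {c = encode ∘ colour} encoded-nonRepetitive
    where
    encoded-nonRepetitive : NonRepetitive Board (encode ∘ colour)
    encoded-nonRepetitive = recolour-nonRepetitive {G = Board} {c = colour} encode-injective board-nonRepetitive

*2≡+ : ∀ m → m * 2 ≡ m + m
*2≡+ m = trans (*-comm m 2) (cong (m +_) (+-identityʳ m))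

square-of-double/2 : ∀ m → (m + m) * (m + m) / 2 ≡ m * (m + m)
square-of-double/2 m = begin
  (m + m) * (m + m) / 2   ≡⟨ cong (λ k → k * (m + m) / 2) (*2≡+ m) ⟨
  m * 2 * (m + m) / 2     ≡⟨ cong (_/ 2) (*-assoc m 2 (m + m)) ⟩
  m * (2 * (m + m)) / 2   ≡⟨ cong (λ k → m * k / 2) (*-comm 2 (m + m)) ⟩
  m * ((m + m) * 2) / 2   ≡⟨ cong (_/ 2) (*-assoc m (m + m) 2) ⟨
  m * (m + m) * 2 / 2     ≡⟨ m*n/n≡m (m * (m + m)) 2 ⟩
  m * (m + m)             ∎
  where open ≡-Reasoning

theorem6 : (n : ℕ) → 2 ∣ n → 4 ≤ n → πAtMost (K n □ K n) ((n * n) / 2)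
theorem6 .(0 * 2) (divides 0 refl) ()
theorem6 .(1 * 2) (divides 1 refl) (s≤s (s≤s ()))
theorem6 .(m * 2) (divides m@(suc (suc _)) refl) _ =
  subst (λ n → πAtMost (K n □ K n) (n * n / 2)) (≡-sym (*2≡+ m))
    (subst (πAtMost (K (m + m) □ K (m + m))) (≡-sym (square-of-double/2 m))
      (Quadrants.quadrant-colouring m rotate rotate-injective rotate-fixedPointFree))
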